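{- Let $P=(G,V_A,V_B)$ be a position of the Maker-Maker domination game and let $v$ be an $A$-trap of $P$. Then claiming $v$ is an optimal move for both players (whichever player is to move). Moreover, $o(P,B)=\mathcal{D}$.
   Context: Maker-Maker domination game: on a finite simple graph $G=(V,E)$, Alice and Bob alternately claim previously unclaimed vertices; the first player whose claimed vertices form a dominating set of $G$ wins; if all vertices are claimed and nobody dominates, it is a draw. A position is $P=(G,V_A,V_B)$ with $V_A\cap V_B=\emptyset$ the vertices already claimed by Alice and Bob respectively. For $t\in\{A,B\}$, $o(P,t)=\mathcal{A}$ if, with player $t$ to move from $P$, Alice has a strategy guaranteeing that her claimed vertices (including $V_A$) dominate $G$ before Bob's do; otherwise $o(P,t)=\mathcal{D}$. $N[w]$ denotes the closed neighbourhood. An $A$-trap of $P$ is an unclaimed vertex $v$ for which there exists a vertex $w$ with $N[w]\setminus V_B=\{v\}$. -}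

module Defs where

open import Data.Nat using (ℕ)
open import Data.Fin using (Fin)
open import Data.Fin.Subset using (Subset; _∈_; _∉_; _∪_; ⁅_⁆)
open import Data.Product using (Σ; ∃; _×_; _,_)
open import Data.Sum using (_⊎_)
open import Data.Empty using (⊥)
open import Relation.Nullary using (¬_)
open import Relation.Binary.PropositionalEquality using (_≡_)
open import Function.Bundles using (_⇔_)

record Graph : Set₁ where
  field
    n     : ℕ
    Adj   : Fin n → Fin n → Set
    sym   : ∀ {x y} → Adj x y → Adj y x
    irrfl : ∀ {x} → ¬ Adj x x
open Graph public

InN[_] : (G : Graph) → Fin (n G) → Fin (n G) → Set
InN[ G ] w x = x ≡ w ⊎ Adj G w x

Dominates : (G : Graph) → Subset (n G) → Set
Dominates G S = ∀ w → ∃ λ x → InN[ G ] w x × x ∈ S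

Disjoint : ∀ {m} → Subset m → Subset m → Set
Disjoint S T = ∀ x → x ∈ S → x ∈ T → ⊥

data Player : Set where
  A B : Player

-- AliceWins G VA VB t : from the position (G,VA,VB) with player t to move,
-- Alice has a strategy making her claimed vertices dominate G before Bob's do,
-- i.e.  o((G,VA,VB),t) = 𝒜.
data AliceWins (G : Graph) : Subset (n G) → Subset (n G) → Player → Set where
  done  : ∀ {VA VB t} → Dominates G VA → ¬ Dominates G VB → AliceWins G VA VB t
  moveA : ∀ {VA VB} → ¬ Dominates G VA → ¬ Dominates G VB →
          (v : Fin (n G)) → v ∉ VA → v ∉ VB →
          AliceWins G (VA ∪ ⁅ v ⁆) VB B → AliceWins G VA VB A
  moveB : ∀ {VA VB} → ¬ Dominates G VA → ¬ Dominates G VB →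
          (∃ λ u → u ∉ VA × u ∉ VB) →
          (∀ v → v ∉ VA → v ∉ VB → AliceWins G VA (VB ∪ ⁅ v ⁆) A) →
          AliceWins G VA VB B

ATrap : (G : Graph) → Subset (n G) → Subset (n G) → Fin (n G) → Set
ATrap G VA VB v = v ∉ VA × v ∉ VB ×
  ∃ λ w → ∀ x → (InN[ G ] w x × x ∉ VB) ⇔ (x ≡ v)

{-# OPTIONS --safe #-}
module Submission where

-- If w witnesses that v is an A-trap, the only vertex of N[w] outside Bob's set is v.
-- Once Bob owns v he owns all of N[w]; Alice, whose vertices stay disjoint from his,
-- can then never dominate w, so the game cannot end in her favour.  Hence Bob, to move,
-- draws by claiming v, and Alice, to move, must claim v herself: any other move hands
-- Bob the same trap.

open import Defs
open import Data.Fin using (_≟_)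
open import Data.Fin.Subset using (Subset; _∪_; ⁅_⁆; _∈_; _∉_)
open import Data.Fin.Subset.Properties
  using (x∈p∪q⁻; x∈p∪q⁺; x∈⁅y⁆⇒x≡y; x∈⁅x⁆; _∈?_)
open import Data.Product using (_×_; _,_; ∃)
open import Data.Sum using (inj₁; inj₂)
open import Data.Empty using (⊥-elim)
open import Relation.Nullary using (¬_; yes; no)
open import Relation.Binary.PropositionalEquality using (_≢_; ≢-sym; refl; subst)
open import Function using (_∘_)
open import Function.Bundles using (_⇔_; mk⇔; Equivalence)

Disjoint-∪⁅⁆ˡ : ∀ {m} {p q : Subset m} {u} → Disjoint p q → u ∉ q → Disjoint (p ∪ ⁅ u ⁆) q
Disjoint-∪⁅⁆ˡ {p = p} {q} {u} p#q u∉q x x∈p∪u x∈q with x∈p∪q⁻ p _ x∈p∪u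
... | inj₁ x∈p = p#q x x∈p x∈q
... | inj₂ x∈u = u∉q (subst (_∈ q) (x∈⁅y⁆⇒x≡y u x∈u) x∈q)

Disjoint-∪⁅⁆ʳ : ∀ {m} {p q : Subset m} {u} → Disjoint p q → u ∉ p → Disjoint p (q ∪ ⁅ u ⁆)
Disjoint-∪⁅⁆ʳ {p = p} {q} {u} p#q u∉p x x∈p x∈q∪u with x∈p∪q⁻ q _ x∈q∪u
... | inj₁ x∈q = p#q x x∈p x∈q
... | inj₂ x∈u = u∉p (subst (_∈ p) (x∈⁅y⁆⇒x≡y u x∈u) x∈p)

∉-∪⁅⁆ : ∀ {m} {p : Subset m} {x u} → x ∉ p → x ≢ u → x ∉ p ∪ ⁅ u ⁆
∉-∪⁅⁆ {p = p} {u = u} x∉p x≢u x∈p∪u with x∈p∪q⁻ p _ x∈p∪u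
... | inj₁ x∈p = x∉p x∈p
... | inj₂ x∈u = x≢u (x∈⁅y⁆⇒x≡y u x∈u)

module _ (G : Graph) where

  AliceWins⇒¬DominatesB : ∀ {VA VB t} → AliceWins G VA VB t → ¬ Dominates G VB
  AliceWins⇒¬DominatesB (done _ ¬domB) = ¬domB
  AliceWins⇒¬DominatesB (moveA _ ¬domB _ _ _ _) = ¬domB
  AliceWins⇒¬DominatesB (moveB _ ¬domB _ _) = ¬domB

  ContainsClosedNbhd : Subset (n G) → Set
  ContainsClosedNbhd S = ∃ λ w → ∀ x → InN[ G ] w x → x ∈ S

  ContainsClosedNbhd-∪ : ∀ {S T} → ContainsClosedNbhd S → ContainsClosedNbhd (S ∪ T)
  ContainsClosedNbhd-∪ (w , N[w]⊆S) = w , λ x x∈N[w] → x∈p∪q⁺ (inj₁ (N[w]⊆S x x∈N[w]))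

  Disjoint∧ContainsClosedNbhd⇒¬Dominates : ∀ {VA VB} → Disjoint VA VB →
    ContainsClosedNbhd VB → ¬ Dominates G VA
  Disjoint∧ContainsClosedNbhd⇒¬Dominates VA#VB (w , N[w]⊆VB) dom with dom w
  ... | x , x∈N[w] , x∈VA = VA#VB x x∈VA (N[w]⊆VB x x∈N[w])

  ContainsClosedNbhd⇒¬AliceWins : ∀ {VA VB t} → Disjoint VA VB →
    ContainsClosedNbhd VB → ¬ AliceWins G VA VB t
  ContainsClosedNbhd⇒¬AliceWins VA#VB cl (done dom _) =
    Disjoint∧ContainsClosedNbhd⇒¬Dominates VA#VB cl dom
  ContainsClosedNbhd⇒¬AliceWins VA#VB cl (moveA _ _ _ _ u∉VB win) =
    ContainsClosedNbhd⇒¬AliceWins (Disjoint-∪⁅⁆ˡ VA#VB u∉VB) cl win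
  ContainsClosedNbhd⇒¬AliceWins VA#VB cl (moveB _ _ (u , u∉VA , u∉VB) win) =
    ContainsClosedNbhd⇒¬AliceWins (Disjoint-∪⁅⁆ʳ VA#VB u∉VA) (ContainsClosedNbhd-∪ cl)
      (win u u∉VA u∉VB)

  ATrap⇒ContainsClosedNbhd : ∀ {VA VB v} → ATrap G VA VB v →
    ContainsClosedNbhd (VB ∪ ⁅ v ⁆)
  ATrap⇒ContainsClosedNbhd {VB = VB} {v} (_ , _ , w , N[w]∖VB≡v) = w , N[w]⊆VB∪v
    where
    N[w]⊆VB∪v : ∀ x → InN[ G ] w x → x ∈ VB ∪ ⁅ v ⁆
    N[w]⊆VB∪v x x∈N[w] with x ∈? VB
    ... | yes x∈VB = x∈p∪q⁺ (inj₁ x∈VB)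
    ... | no x∉VB with Equivalence.to (N[w]∖VB≡v x) (x∈N[w] , x∉VB)
    ...   | refl = x∈p∪q⁺ (inj₂ (x∈⁅x⁆ v))

  ATrap⇒¬Dominates : ∀ {VA VB v} → Disjoint VA VB → ATrap G VA VB v → ¬ Dominates G VA
  ATrap⇒¬Dominates VA#VB trap@(v∉VA , _) =
    Disjoint∧ContainsClosedNbhd⇒¬Dominates (Disjoint-∪⁅⁆ʳ VA#VB v∉VA)
      (ATrap⇒ContainsClosedNbhd trap)

  ATrap⇒¬AliceWins-∪⁅⁆ʳ : ∀ {VA VB v t} → Disjoint VA VB → ATrap G VA VB v →
    ¬ AliceWins G VA (VB ∪ ⁅ v ⁆) t
  ATrap⇒¬AliceWins-∪⁅⁆ʳ VA#VB trap@(v∉VA , _) =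
    ContainsClosedNbhd⇒¬AliceWins (Disjoint-∪⁅⁆ʳ VA#VB v∉VA) (ATrap⇒ContainsClosedNbhd trap)

  ATrap-∪⁅⁆ˡ : ∀ {VA VB u v} → u ≢ v → ATrap G VA VB v → ATrap G (VA ∪ ⁅ u ⁆) VB v
  ATrap-∪⁅⁆ˡ u≢v (v∉VA , v∉VB , w) = ∉-∪⁅⁆ v∉VA (≢-sym u≢v) , v∉VB , w

  ATrap⇒¬AliceWins-B : ∀ {VA VB v} → Disjoint VA VB → ATrap G VA VB v →
    ¬ AliceWins G VA VB B
  ATrap⇒¬AliceWins-B VA#VB trap (done dom _) = ATrap⇒¬Dominates VA#VB trap dom
  ATrap⇒¬AliceWins-B VA#VB trap@(v∉VA , v∉VB , _) (moveB _ _ _ win) =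
    ATrap⇒¬AliceWins-∪⁅⁆ʳ VA#VB trap (win _ v∉VA v∉VB)

  ATrap⇒AliceWins-A⇔∪⁅⁆ˡ : ∀ {VA VB v} → Disjoint VA VB → ATrap G VA VB v →
    AliceWins G VA VB A ⇔ AliceWins G (VA ∪ ⁅ v ⁆) VB B
  ATrap⇒AliceWins-A⇔∪⁅⁆ˡ {VA} {VB} {v} VA#VB trap@(v∉VA , v∉VB , _) = mk⇔ to from
    where
    to : AliceWins G VA VB A → AliceWins G (VA ∪ ⁅ v ⁆) VB B
    to (done dom _) = ⊥-elim (ATrap⇒¬Dominates VA#VB trap dom)
    to (moveA _ _ u _ u∉VB win) with u ≟ v
    ... | yes refl = win
    ... | no u≢v =
      ⊥-elim (ATrap⇒¬AliceWins-B (Disjoint-∪⁅⁆ˡ VA#VB u∉VB) (ATrap-∪⁅⁆ˡ u≢v trap) win)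

    from : AliceWins G (VA ∪ ⁅ v ⁆) VB B → AliceWins G VA VB A
    from win =
      moveA (ATrap⇒¬Dominates VA#VB trap) (AliceWins⇒¬DominatesB win) v v∉VA v∉VB win

lemma3 : (G : Graph) (VA VB : Subset (n G)) → Disjoint VA VB →
    (v : _) → ATrap G VA VB v →
    (AliceWins G VA VB A ⇔ AliceWins G (VA ∪ ⁅ v ⁆) VB B)
    × (AliceWins G VA VB B ⇔ AliceWins G VA (VB ∪ ⁅ v ⁆) A)
    × ¬ AliceWins G VA VB B
lemma3 G VA VB VA#VB v trap =
  ATrap⇒AliceWins-A⇔∪⁅⁆ˡ G VA#VB trap ,
  mk⇔ (⊥-elim ∘ ¬winB) (⊥-elim ∘ ATrap⇒¬AliceWins-∪⁅⁆ʳ G VA#VB trap) ,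
  ¬winB
  where
  ¬winB : ¬ AliceWins G VA VB B
  ¬winB = ATrap⇒¬AliceWins-B G VA#VB trap
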